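{- Let $r \ge 3$ and let $a$ be a positive integer. There is a value $n_0$ (depending on $r$ and $a$) such that for every $n \ge n_0$ and every digraph $D$ of order $n$ and outradius $r$ with $W(D)<2\binom{n}{2}+a n$, there is a vertex $v$ of $D$ such that $D - v$ has outradius $r$ and the distance between any two vertices of $D-v$ in $D-v$ equals their distance in $D$.
   Context: $d(x,y)$ is the directed shortest path distance, $W(D)=\sum_{(u,v)\in V^2} d(u,v)$ over ordered pairs, the outradius of $D$ is $\min_x\max_v d(x,v)$, and $D-v$ is $D$ with $v$ deleted. -}

module Defs where

open import Data.Nat using (ℕ; zero; suc; _+_; _≤_; pred)
open import Data.Bool using (Bool; true; false; _∨_; _∧_; if_then_else_)
open import Data.Fin using (Fin; punchIn; _≟_)
open import Relation.Nullary.Decidable using (⌊_⌋)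
open import Data.List using (List; []; _∷_; map; concatMap; allFin)
open import Data.Bool.ListAction using (any)
open import Data.Maybe using (Maybe; just; nothing)
import Data.Maybe as Maybe
open import Data.Product using (Σ; ∃; ∃-syntax; _×_; _,_)
open import Relation.Binary.PropositionalEquality using (_≡_; cong)

record Digraph (n : ℕ) : Set where
  field
    arc      : Fin n → Fin n → Bool
    loopless : ∀ v → arc v v ≡ false
open Digraph public

reach : ∀ {n} → Digraph n → ℕ → Fin n → Fin n → Bool
reach {n} D zero    u v = ⌊ u ≟ v ⌋
reach {n} D (suc k) u v =
  reach D k u v ∨ any (λ w → reach D k u w ∧ arc D w v) (allFin n)

least : (ℕ → Bool) → ℕ → Maybe ℕ
least p zero    = nothing
least p (suc b) = if p 0 then just 0 else Maybe.map suc (least (λ k → p (suc k)) b)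

-- Directed shortest-path distance d(u,v); nothing = ∞ (v not reachable from u).
-- A shortest walk has at most n - 1 arcs, so searching k < n suffices.
dist : ∀ {n} → Digraph n → Fin n → Fin n → Maybe ℕ
dist {n} D u v = least (λ k → reach D k u v) n

DistLe : ∀ {n} → Digraph n → Fin n → Fin n → ℕ → Set
DistLe D u v k = ∃[ m ] (dist D u v ≡ just m × m ≤ k)

EccLe : ∀ {n} → Digraph n → Fin n → ℕ → Set
EccLe {n} D x k = ∀ (v : Fin n) → DistLe D x v k

OutradiusIs : ∀ {n} → Digraph n → ℕ → Set
OutradiusIs {n} D r =
  (∃[ x ] EccLe D x r) × (∀ (x : Fin n) (k : ℕ) → EccLe D x k → r ≤ k)

sumMaybe : List (Maybe ℕ) → Maybe ℕ
sumMaybe []              = just 0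
sumMaybe (nothing ∷ xs)  = nothing
sumMaybe (just x ∷ xs)   = Maybe.map (x +_) (sumMaybe xs)

W : ∀ {n} → Digraph n → Maybe ℕ
W {n} D = sumMaybe (concatMap (λ u → map (λ v → dist D u v) (allFin n)) (allFin n))

WLess : ∀ {n} → Digraph n → ℕ → Set
WLess D b = ∃[ w ] (W D ≡ just w × suc w ≤ b)

embed : ∀ {n} → Fin n → Fin (pred n) → Fin n
embed {suc m} v x = punchIn v x

_─_ : ∀ {n} → Digraph n → Fin n → Digraph (pred n)
_─_ {suc m} D v = record
  { arc      = λ x y → arc D (punchIn v x) (punchIn v y)
  ; loopless = λ x → loopless D (punchIn v x) }

-- Deleting v preserves all distances as soon as every 2-path p → v → q with p ≠ q and no arc
-- p → q has a second middle vertex. An ordered pair contributes 1 to W(D), and at least 2 if it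
-- is not an arc, so W(D) < n(n - 1) + an means that fewer than an arcs are missing. Hence at most
-- 2a vertices miss arcs to half of the others (a half gap) and fewer than n/(8a) miss 8a² of
-- them (a large gap). If p, q have no second middle then n ≤ 1 + outGap p + inGap q; since two
-- vertices without half gaps always have two common middles, p or q has a half gap, and then v is
-- either the unique middle towards a vertex with a large gap or a neighbour of a vertex of degree
-- below 8a². Together with the centre and one far vertex per half-gap vertex these choices cover
-- fewer than n vertices once n ≥ 2 + 8a + 64a³, and any other v can be deleted. The outradius
-- survives: the centre stays, each half-gap vertex keeps its far vertex, and every other vertex
-- reaches v within 2 ≤ r - 1 steps.
module Submission where

open import Data.Bool using (Bool; true; false; T; not; _∧_)
open import Data.Bool.Properties using (T-∧; T-∨; T?)
open import Data.Empty using (⊥-elim)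
open import Data.Fin using (Fin; zero; suc; _≟_; punchIn; punchOut)
open import Data.Fin.Patterns using (0F; 1F; 2F; 3F; 4F; 5F; 6F)
open import Data.Fin.Properties using (punchInᵢ≢i; punchIn-punchOut; punchIn-injective; ¬∀⟶∃¬; all?)
open import Data.Nat hiding (_≟_)
open import Data.Nat.Properties hiding (_≟_)
open import Data.Nat.Tactic.RingSolver using (solve-∀)
open import Data.Nat.Combinatorics using (_C_; nC1≡n; nCk+nC[k+1]≡[n+1]C[k+1])
open import Data.Product using (∃-syntax; _×_; _,_; proj₁; proj₂)
open import Data.List using (List; []; _∷_; _++_; map; concat; tabulate; allFin)
open import Data.List.Properties using (map-tabulate; tabulate-cong)
open import Data.List.Membership.Propositional using (lose)
open import Data.List.Membership.Propositional.Properties using (∈-allFin)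
open import Data.List.Relation.Unary.Any using (satisfied)
open import Data.List.Relation.Unary.Any.Properties using (any⁺; any⁻)
open import Data.Maybe using (Maybe; just; nothing)
import Data.Maybe as Maybe
open import Data.Sum using (_⊎_; inj₁; inj₂)
open import Function using (_∘_; Equivalence)
open import Relation.Binary.PropositionalEquality
open import Relation.Nullary using (¬_; Dec; yes; no; _→-dec_)
open import Relation.Nullary.Decidable
  using (⌊_⌋; map′; toWitness; fromWitness; toWitnessFalse; fromWitnessFalse; decidable-stable)
open import Algebra.Properties.Semiring.Sum +-*-semiring
  using (sum; sum-syntax; sum-remove; sum-cong-≗; ∑-distrib-+; ∑-comm; *-distribˡ-sum; *-distribʳ-sum)

open import Defs

𝟙 : Bool → ℕ
𝟙 true  = 1
𝟙 false = 0

𝟙-true : ∀ {b} → T b → 𝟙 b ≡ 1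
𝟙-true {true} _ = refl

𝟙-false : ∀ {b} → ¬ T b → 𝟙 b ≡ 0
𝟙-false {true}  ¬b = ⊥-elim (¬b _)
𝟙-false {false} _  = refl

𝟙≤1 : ∀ b → 𝟙 b ≤ 1
𝟙≤1 true  = ≤-refl
𝟙≤1 false = z≤n

𝟙-covers : ∀ {b₁ b₂ b₃} → T b₁ ⊎ T b₂ ⊎ T b₃ → 1 ≤ 𝟙 b₁ + 𝟙 b₂ + 𝟙 b₃
𝟙-covers {true}                 _                = s≤s z≤n
𝟙-covers {false} {true}         _                = s≤s z≤n
𝟙-covers {false} {false} {true} _                = s≤s z≤n
𝟙-covers {false} {false} {false} (inj₂ (inj₂ ()))

T-ext : ∀ {a b} → (T a → T b) → (T b → T a) → a ≡ b
T-ext {true}  {true}  _   _   = refl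
T-ext {true}  {false} a⇒b _   = ⊥-elim (a⇒b _)
T-ext {false} {true}  _   b⇒a = ⊥-elim (b⇒a _)
T-ext {false} {false} _   _   = refl

T-not : ∀ {b} → ¬ T b → T (not b)
T-not {true}  ¬b = ¬b _
T-not {false} _  = _

T-∧-intro : ∀ b c → T b → T c → T (b ∧ c)
T-∧-intro _ _ b c = Equivalence.from T-∧ (b , c)

count : ∀ {n} → (Fin n → Bool) → ℕ
count {n} P = ∑[ i < n ] 𝟙 (P i)

∑-mono-≤ : ∀ {n} {f g : Fin n → ℕ} → (∀ i → f i ≤ g i) → sum f ≤ sum g
∑-mono-≤ {zero}  f≤g = z≤n
∑-mono-≤ {suc n} f≤g = +-mono-≤ (f≤g zero) (∑-mono-≤ (f≤g ∘ suc))

∑-const : ∀ n c → ∑[ i < n ] c ≡ n * c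
∑-const zero    c = refl
∑-const (suc n) c = cong (c +_) (∑-const n c)

∑1≡n : ∀ n → ∑[ i < n ] 1 ≡ n
∑1≡n n = trans (∑-const n 1) (*-identityʳ n)

∑[1+2*g]≡n+2*∑g : ∀ {n} (g : Fin n → ℕ) → ∑[ x < n ] suc (2 * g x) ≡ n + 2 * sum g
∑[1+2*g]≡n+2*∑g {n} g = begin
  ∑[ x < n ] (1 + 2 * g x)            ≡⟨ ∑-distrib-+ (λ _ → 1) (λ x → 2 * g x) ⟩
  ∑[ x < n ] 1 + ∑[ x < n ] (2 * g x) ≡⟨ cong₂ _+_ (∑1≡n n) (sym (*-distribˡ-sum 2 g)) ⟩
  n + 2 * sum g                       ∎
  where open ≡-Reasoning

term≤∑ : ∀ {n} (f : Fin n → ℕ) i → f i ≤ sum f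
term≤∑ f zero    = m≤m+n (f zero) _
term≤∑ f (suc i) = ≤-trans (term≤∑ (f ∘ suc) i) (m≤n+m _ (f zero))

∑≡0⇒≡0 : ∀ {n} (f : Fin n → ℕ) → sum f ≡ 0 → ∀ i → f i ≡ 0
∑≡0⇒≡0 f ∑f≡0 i = n≤0⇒n≡0 (≤-trans (term≤∑ f i) (≤-reflexive ∑f≡0))

∑<n⇒∃≡0 : ∀ {n} (f : Fin n → ℕ) → sum f < n → ∃[ i ] f i ≡ 0
∑<n⇒∃≡0 {suc n} f ∑f<n with f zero in eq
... | zero  = zero , eq
... | suc k with ∑<n⇒∃≡0 (f ∘ suc) (≤-trans (s≤s (m≤n+m _ k)) (s≤s⁻¹ ∑f<n))
...   | i , fi≡0 = suc i , fi≡0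

count>0⇒∃ : ∀ {n} (P : Fin n → Bool) → 0 < count P → ∃[ i ] T (P i)
count>0⇒∃ {suc n} P 0<count with P zero in eq
... | true  = zero , subst T (sym eq) _
... | false with count>0⇒∃ (P ∘ suc) 0<count
...   | i , Pi = suc i , Pi

count-mono : ∀ {n} {P Q : Fin n → Bool} → (∀ i → T (P i) → T (Q i)) → count P ≤ count Q
count-mono {P = P} {Q} P⊆Q = ∑-mono-≤ pointwise
  where
  pointwise : ∀ i → 𝟙 (P i) ≤ 𝟙 (Q i)
  pointwise i with P i | P⊆Q i
  ... | true  | Pi⇒Qi = ≤-reflexive (sym (𝟙-true (Pi⇒Qi _)))
  ... | false | _     = z≤n

count≤n : ∀ {n} (P : Fin n → Bool) → count P ≤ n
count≤n {n} P = ≤-trans (∑-mono-≤ (𝟙≤1 ∘ P)) (≤-reflexive (∑1≡n n))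

count-full : ∀ {n} (P : Fin n → Bool) → n ≤ count P → ∀ i → T (P i)
count-full {suc n} P full i with T? (P i)
... | yes Pi = Pi
... | no ¬Pi = ⊥-elim (1+n≰n (≤-trans full (begin
  count P                           ≡⟨ sum-remove {i = i} (𝟙 ∘ P) ⟩
  𝟙 (P i) + count (P ∘ punchIn i)   ≡⟨ cong (_+ count (P ∘ punchIn i)) (𝟙-false ¬Pi) ⟩
  count (P ∘ punchIn i)             ≤⟨ count≤n (P ∘ punchIn i) ⟩
  n                                 ∎)))
  where open ≤-Reasoning

count-< : ∀ {n} {P Q : Fin n → Bool} → (∀ i → T (P i) → T (Q i)) → ¬ (∀ i → T (Q i) → T (P i)) →
          count P < count Q
count-< {zero}          P⊆Q Q⊈P = ⊥-elim (Q⊈P (λ ()))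
count-< {suc n} {P} {Q} P⊆Q Q⊈P with ¬∀⟶∃¬ (suc n) _ (λ i → T? (Q i) →-dec T? (P i)) Q⊈P
... | i , Qi⇏Pi = begin-strict
  count P                           ≡⟨ sum-remove {i = i} (𝟙 ∘ P) ⟩
  𝟙 (P i) + count (P ∘ punchIn i)   ≡⟨ cong (_+ count (P ∘ punchIn i)) (𝟙-false (λ Pi → Qi⇏Pi (λ _ → Pi))) ⟩
  count (P ∘ punchIn i)             ≤⟨ count-mono (P⊆Q ∘ punchIn i) ⟩
  count (Q ∘ punchIn i)             <⟨ n<1+n _ ⟩
  1 + count (Q ∘ punchIn i)         ≡⟨ cong (_+ count (Q ∘ punchIn i)) (𝟙-true Qi) ⟨
  𝟙 (Q i) + count (Q ∘ punchIn i)   ≡⟨ sum-remove {i = i} (𝟙 ∘ Q) ⟨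
  count Q                           ∎
  where
  open ≤-Reasoning
  Qi : T (Q i)
  Qi = decidable-stable (T? (Q i)) (λ ¬Qi → Qi⇏Pi (⊥-elim ∘ ¬Qi))

count-∧≤ : ∀ {n} b (P : Fin n → Bool) c → (T b → count P ≤ c) → count (λ i → b ∧ P i) ≤ c
count-∧≤ {n} true  P c ≤c = ≤c _
count-∧≤ {n} false P c _  = ≤-trans (≤-reflexive (trans (∑-const n 0) (*-zeroʳ n))) z≤n

count-≟ : ∀ {n} (i : Fin n) → count (λ j → ⌊ i ≟ j ⌋) ≡ 1
count-≟ {suc n} i = begin
  count (λ j → ⌊ i ≟ j ⌋)
    ≡⟨ sum-remove {i = i} (λ j → 𝟙 ⌊ i ≟ j ⌋) ⟩
  𝟙 ⌊ i ≟ i ⌋ + ∑[ j < n ] 𝟙 ⌊ i ≟ punchIn i j ⌋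
    ≡⟨ cong₂ _+_ (𝟙-true (fromWitness refl)) (sum-cong-≗ off-diagonal) ⟩
  1 + ∑[ j < n ] 0
    ≡⟨ cong suc (trans (∑-const n 0) (*-zeroʳ n)) ⟩
  1 ∎
  where
  open ≡-Reasoning
  off-diagonal : ∀ j → 𝟙 ⌊ i ≟ punchIn i j ⌋ ≡ 0
  off-diagonal j = 𝟙-false (punchInᵢ≢i i j ∘ sym ∘ toWitness)

⌊≟⌋-comm : ∀ {n} (i j : Fin n) → ⌊ i ≟ j ⌋ ≡ ⌊ j ≟ i ⌋
⌊≟⌋-comm i j = T-ext (fromWitness ∘ sym ∘ toWitness) (fromWitness ∘ sym ∘ toWitness)

count-≢ : ∀ {n} (i : Fin n) → count (λ j → not ⌊ i ≟ j ⌋) ≡ n ∸ 1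
count-≢ {suc n} i = begin
  count (λ j → not ⌊ i ≟ j ⌋)
    ≡⟨ sum-remove {i = i} (λ j → 𝟙 (not ⌊ i ≟ j ⌋)) ⟩
  𝟙 (not ⌊ i ≟ i ⌋) + ∑[ j < n ] 𝟙 (not ⌊ i ≟ punchIn i j ⌋)
    ≡⟨ cong₂ _+_ (𝟙-false (λ i≢i → toWitnessFalse i≢i refl)) (sum-cong-≗ off-diagonal) ⟩
  ∑[ j < n ] 1
    ≡⟨ ∑1≡n n ⟩
  n ∎
  where
  open ≡-Reasoning
  off-diagonal : ∀ j → 𝟙 (not ⌊ i ≟ punchIn i j ⌋) ≡ 1
  off-diagonal j = 𝟙-true (fromWitnessFalse (punchInᵢ≢i i j ∘ sym))

2≤count⇒∃≢ : ∀ {n} (P : Fin n → Bool) (v : Fin n) → 2 ≤ count P → ∃[ w ] (w ≢ v × T (P w))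
2≤count⇒∃≢ {suc n} P v 2≤count =
  let j , Pj = count>0⇒∃ (P ∘ punchIn v) others>0 in punchIn v j , punchInᵢ≢i v j , Pj
  where
  others>0 : 0 < count (P ∘ punchIn v)
  others>0 = +-cancelˡ-≤ 1 1 _ (≤-trans 2≤count (≤-trans (≤-reflexive (sum-remove {i = v} (𝟙 ∘ P)))
                                                          (+-monoˡ-≤ _ (𝟙≤1 (P v)))))

markov : ∀ {n} t (g : Fin n → ℕ) → count (λ x → ⌊ t ≤? g x ⌋) * t ≤ sum g
markov {n} t g = begin
  count (λ x → ⌊ t ≤? g x ⌋) * t   ≡⟨ *-distribʳ-sum t (λ x → 𝟙 ⌊ t ≤? g x ⌋) ⟩
  ∑[ x < n ] (𝟙 ⌊ t ≤? g x ⌋ * t)  ≤⟨ ∑-mono-≤ pointwise ⟩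
  sum g                             ∎
  where
  open ≤-Reasoning
  pointwise : ∀ x → 𝟙 ⌊ t ≤? g x ⌋ * t ≤ g x
  pointwise x with t ≤? g x
  ... | yes t≤gx = ≤-trans (≤-reflexive (+-identityʳ t)) t≤gx
  ... | no _     = z≤n

∑∑-guarded≤ : ∀ {m n} (P : Fin m → Bool) (h : Fin m → Fin n → ℕ) c →
              (∀ x → ∑[ v < n ] h x v ≤ c) →
              ∑[ v < n ] ∑[ x < m ] (𝟙 (P x) * h x v) ≤ count P * c
∑∑-guarded≤ {m} {n} P h c ∑h≤c = begin
  ∑[ v < n ] ∑[ x < m ] (𝟙 (P x) * h x v)   ≡⟨ ∑-comm (λ x v → 𝟙 (P x) * h x v) ⟨
  ∑[ x < m ] ∑[ v < n ] (𝟙 (P x) * h x v)   ≡⟨ sum-cong-≗ (λ x → *-distribˡ-sum (𝟙 (P x)) (h x)) ⟨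
  ∑[ x < m ] (𝟙 (P x) * ∑[ v < n ] h x v)   ≤⟨ ∑-mono-≤ (λ x → *-monoʳ-≤ (𝟙 (P x)) (∑h≤c x)) ⟩
  ∑[ x < m ] (𝟙 (P x) * c)                  ≡⟨ *-distribʳ-sum c (𝟙 ∘ P) ⟨
  count P * c                               ∎
  where open ≤-Reasoning

∑∑-guarded≤count : ∀ {m n} (P : Fin m → Bool) (h : Fin m → Fin n → ℕ) →
                   (∀ x → ∑[ v < n ] h x v ≤ 1) →
                   ∑[ v < n ] ∑[ x < m ] (𝟙 (P x) * h x v) ≤ count P
∑∑-guarded≤count P h ∑h≤1 = ≤-trans (∑∑-guarded≤ P h 1 ∑h≤1) (≤-reflexive (*-identityʳ (count P)))

guarded-∑≡0 : ∀ {m} (P : Fin m → Bool) (h : Fin m → ℕ) →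
              ∑[ x < m ] (𝟙 (P x) * h x) ≡ 0 → ∀ x → T (P x) → h x ≡ 0
guarded-∑≡0 P h ∑≡0 x Px = begin
  h x           ≡⟨ +-identityʳ (h x) ⟨
  1 * h x       ≡⟨ cong (_* h x) (𝟙-true Px) ⟨
  𝟙 (P x) * h x ≡⟨ ∑≡0⇒≡0 (λ x → 𝟙 (P x) * h x) ∑≡0 x ⟩
  0             ∎
  where open ≡-Reasoning

least-cong : ∀ {p q : ℕ → Bool} b → (∀ k → p k ≡ q k) → least p b ≡ least q b
least-cong zero    p≗q = refl
least-cong (suc b) p≗q rewrite p≗q 0 | least-cong b (p≗q ∘ suc) = refl

least-sound : ∀ (p : ℕ → Bool) b {m} → least p b ≡ just m → T (p m)
least-sound p (suc b) {m} eq with p 0 in p0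
least-sound p (suc b) refl | true  = subst T (sym p0) _
... | false with least (p ∘ suc) b in eq′
least-sound p (suc b) refl | false | just m = least-sound (p ∘ suc) b eq′

least-complete : ∀ (p : ℕ → Bool) b k → T (p k) → k < b → ∃[ m ] (least p b ≡ just m × m ≤ k)
least-complete p (suc b) zero    pk _ with p 0
... | true  = 0 , refl , z≤n
... | false = ⊥-elim pk
least-complete p (suc b) (suc k) pk k<b with p 0
... | true  = 0 , refl , z≤n
... | false with least-complete (p ∘ suc) b k pk (s≤s⁻¹ k<b)
...   | m , eq , m≤k rewrite eq = suc m , refl , s≤s m≤k

least-suc : ∀ (p : ℕ → Bool) b → (T (p b) → ∃[ k ] (k < b × T (p k))) → least p (suc b) ≡ least p b
least-suc p zero earlier with p 0
... | true  = ⊥-elim (n≮0 (proj₁ (proj₂ (earlier _))))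
... | false = refl
least-suc p (suc b) earlier with p 0 in p0
... | true  = refl
... | false = cong (Maybe.map suc) (least-suc (p ∘ suc) b earlier′)
  where
  earlier′ : T (p (suc b)) → ∃[ k ] (k < b × T (p (suc k)))
  earlier′ pb with earlier pb
  ... | zero  , _   , pk = ⊥-elim (subst T p0 pk)
  ... | suc k , k<b , pk = k , s≤s⁻¹ k<b , pk

-- Walks of bounded length

-- Wrapping T (reach D k u z) in a record lets Agda infer u and z by unification.
record Reach {n} (D : Digraph n) (k : ℕ) (u z : Fin n) : Set where
  constructor reached
  field reach-true : T (reach D k u z)
open Reach

module _ {n} (D : Digraph n) where

  reach-zero : ∀ {u z} → Reach D 0 u z → u ≡ z
  reach-zero (reached r) = toWitness r

  reach-suc : ∀ {k u z} → Reach D k u z → Reach D (suc k) u z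
  reach-suc (reached r) = reached (Equivalence.from T-∨ (inj₁ r))

  reach-refl : ∀ {k} u → Reach D k u u
  reach-refl {zero}  u = reached (fromWitness refl)
  reach-refl {suc k} u = reach-suc (reach-refl u)

  reach-step : ∀ {k u w z} → Reach D k u w → T (arc D w z) → Reach D (suc k) u z
  reach-step {w = w} (reached r) a =
    reached (Equivalence.from T-∨ (inj₂ (any⁺ _ (lose (∈-allFin w) (Equivalence.from T-∧ (r , a))))))

  reach-suc⁻ : ∀ {k u z} → Reach D (suc k) u z →
               Reach D k u z ⊎ ∃[ w ] (Reach D k u w × T (arc D w z))
  reach-suc⁻ {k} {u} {z} (reached r) with Equivalence.to T-∨ r
  ... | inj₁ r′ = inj₁ (reached r′)
  ... | inj₂ via with satisfied (any⁻ (λ w → reach D k u w ∧ arc D w z) (allFin n) via)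
  ...   | w , rw = let r′ , a = Equivalence.to T-∧ rw in inj₂ (w , reached r′ , a)

  reach-mono : ∀ {k k′ u z} → k ≤ k′ → Reach D k u z → Reach D k′ u z
  reach-mono k≤k′ = go (≤⇒≤′ k≤k′)
    where
    go : ∀ {k k′ u z} → k ≤′ k′ → Reach D k u z → Reach D k′ u z
    go (≤′-reflexive refl) r = r
    go (≤′-step k≤′k′)     r = reach-suc (go k≤′k′ r)

  reach-arc : ∀ {u z} → u ≢ z → Reach D 1 u z → T (arc D u z)
  reach-arc u≢z r with reach-suc⁻ r
  ... | inj₁ r₀           = ⊥-elim (u≢z (reach-zero r₀))
  ... | inj₂ (w , r₀ , a) rewrite reach-zero r₀ = a

  Saturated : Fin n → ℕ → Set
  Saturated u j = ∀ z → Reach D (suc j) u z → Reach D j u z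

  saturated-absorbs : ∀ {u j} → Saturated u j → ∀ k {z} → Reach D k u z → Reach D j u z
  saturated-absorbs sat zero    r = reach-mono z≤n r
  saturated-absorbs sat (suc k) r with reach-suc⁻ r
  ... | inj₁ r′           = saturated-absorbs sat k r′
  ... | inj₂ (w , r′ , a) = sat _ (reach-step (saturated-absorbs sat k r′) a)

  saturated-or-growing : ∀ u k → (∃[ j ] (j ≤ k × Saturated u j)) ⊎ suc k ≤ count (reach D k u)
  saturated-or-growing u zero = inj₂ (≤-trans (≤-reflexive (sym (𝟙-true (reach-true (reach-refl {0} u)))))
                                              (term≤∑ (𝟙 ∘ reach D 0 u) u))
  saturated-or-growing u (suc k) with saturated-or-growing u k
  ... | inj₁ (j , j≤k , sat) = inj₁ (j , m≤n⇒m≤1+n j≤k , sat)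
  ... | inj₂ grown with all? (λ z → T? (reach D (suc k) u z) →-dec T? (reach D k u z))
  ...   | yes sat = inj₁ (k , n≤1+n k , λ z → reached ∘ sat z ∘ reach-true)
  ...   | no ¬sat = inj₂ (≤-trans (s≤s grown) (count-< {P = reach D k u} grows ¬sat))
    where
    grows : ∀ z → T (reach D k u z) → T (reach D (suc k) u z)
    grows z r = reach-true (reach-suc {k = k} (reached r))

reach-ceiling : ∀ {m} (D : Digraph (suc m)) k {u z} → Reach D k u z → Reach D m u z
reach-ceiling {m} D k {u} {z} r with saturated-or-growing D u m
... | inj₁ (j , j≤m , sat) = reach-mono D j≤m (saturated-absorbs D sat k r)
... | inj₂ full            = reached (count-full (reach D m u) full z)

reach⇒DistLe : ∀ {n} (D : Digraph n) k {u z} → Reach D k u z → DistLe D u z k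
reach⇒DistLe {suc m} D k {u} {z} r with k ≤? m
... | yes k≤m = least-complete (λ j → reach D j u z) (suc m) k (reach-true r) (s≤s k≤m)
... | no k≰m with least-complete (λ j → reach D j u z) (suc m) m (reach-true (reach-ceiling D k r)) ≤-refl
...   | d , eq , d≤m = d , eq , ≤-trans d≤m (<⇒≤ (≰⇒> k≰m))

-- Deleting a vertex

Bypass : ∀ {n} → Digraph n → Fin n → Set
Bypass D v = ∀ {p q} → p ≢ q → T (arc D p v) → T (arc D v q) → ¬ T (arc D p q) →
             ∃[ w ] (w ≢ v × T (arc D p w) × T (arc D w q))

punchIn-onto : ∀ {m} {v w : Fin (suc m)} → w ≢ v → ∃[ x ] punchIn v x ≡ w
punchIn-onto w≢v = punchOut (w≢v ∘ sym) , punchIn-punchOut (w≢v ∘ sym)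

module _ {m} (D : Digraph (suc m)) (v : Fin (suc m)) where

  private
    ι : Fin m → Fin (suc m)
    ι = punchIn v

  reach-─⇒ : ∀ {k x y} → Reach (D ─ v) k x y → Reach D k (ι x) (ι y)
  reach-─⇒ {zero} r rewrite reach-zero (D ─ v) r = reach-refl D _
  reach-─⇒ {suc k} r with reach-suc⁻ (D ─ v) r
  ... | inj₁ r′           = reach-suc D (reach-─⇒ r′)
  ... | inj₂ (w , r′ , a) = reach-step D (reach-─⇒ r′) a

  module _ (bypass : Bypass D v) where

    reach⇒─     : ∀ {k x y} → Reach D k (ι x) (ι y) → Reach (D ─ v) k x y
    reach-via⇒─ : ∀ {k x y} → Reach D k (ι x) v → T (arc D v (ι y)) → Reach (D ─ v) (suc k) x y

    reach⇒─ {zero} {x} {y} r rewrite punchIn-injective v x y (reach-zero D r) = reach-refl (D ─ v) y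
    reach⇒─ {suc k} r with reach-suc⁻ D r
    ... | inj₁ r′ = reach-suc (D ─ v) (reach⇒─ r′)
    ... | inj₂ (w , r′ , a) with w ≟ v
    ...   | yes refl = reach-via⇒─ r′ a
    ...   | no w≢v with punchIn-onto w≢v
    ...     | w′ , refl = reach-step (D ─ v) (reach⇒─ r′) a

    reach-via⇒─ {zero} {x} r _ = ⊥-elim (punchInᵢ≢i v x (reach-zero D r))
    reach-via⇒─ {suc k} {x} {y} r vy with reach-suc⁻ D r
    ... | inj₁ r′ = reach-suc (D ─ v) (reach-via⇒─ r′ vy)
    ... | inj₂ (w , r′ , wv) with w ≟ v
    ...   | yes refl = ⊥-elim (subst T (loopless D v) wv)
    ...   | no w≢v with punchIn-onto w≢v
    ...     | w′ , refl with w′ ≟ y | T? (arc D (ι w′) (ι y))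
    ...       | yes refl | _     = reach-mono (D ─ v) (n≤1+n _) (reach-suc (D ─ v) (reach⇒─ r′))
    ...       | no w′≢y  | yes a = reach-suc (D ─ v) (reach-step (D ─ v) (reach⇒─ r′) a)
    ...       | no w′≢y  | no ¬a with bypass (w′≢y ∘ punchIn-injective v w′ y) wv vy ¬a
    ...         | u , u≢v , a₁ , a₂ with punchIn-onto u≢v
    ...           | u′ , refl = reach-step (D ─ v) (reach-step (D ─ v) (reach⇒─ r′) a₁) a₂

dist-─ : ∀ {m} (D : Digraph (suc m)) v → Bypass D v →
         ∀ x y → dist (D ─ v) x y ≡ dist D (punchIn v x) (punchIn v y)
dist-─ {suc m} D v bypass x y = begin
  least (λ k → reach (D ─ v) k x y) (suc m)                      ≡⟨ least-cong (suc m) same-reach ⟩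
  least (λ k → reach D k (punchIn v x) (punchIn v y)) (suc m)    ≡⟨ least-suc _ (suc m) shorter ⟨
  least (λ k → reach D k (punchIn v x) (punchIn v y)) (suc (suc m)) ∎
  where
  open ≡-Reasoning
  same-reach : ∀ k → reach (D ─ v) k x y ≡ reach D k (punchIn v x) (punchIn v y)
  same-reach k = T-ext (λ r → reach-true (reach-─⇒ D v {k} (reached r)))
                       (λ r → reach-true (reach⇒─ D v bypass {k} (reached r)))
  shorter : T (reach D (suc m) (punchIn v x) (punchIn v y)) →
            ∃[ k ] (k < suc m × T (reach D k (punchIn v x) (punchIn v y)))
  shorter r = m , ≤-refl ,
    reach-true (reach-─⇒ D v (reach-ceiling (D ─ v) (suc m) (reach⇒─ D v bypass {suc m} (reached r))))

DistLe-weaken : ∀ {d : Maybe ℕ} {k k′} → k ≤ k′ →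
                ∃[ m ] (d ≡ just m × m ≤ k) → ∃[ m ] (d ≡ just m × m ≤ k′)
DistLe-weaken k≤k′ (d , eq , d≤k) = d , eq , ≤-trans d≤k k≤k′

≤⊔∸1⇒≤ : ∀ r k → r ≤ k ⊔ (r ∸ 1) → r ≤ k
≤⊔∸1⇒≤ zero    k _ = z≤n
≤⊔∸1⇒≤ (suc r) k r<k⊔r with ⊔-sel k r
... | inj₁ k⊔r≡k = subst (suc r ≤_) k⊔r≡k r<k⊔r
... | inj₂ k⊔r≡r = ⊥-elim (1+n≰n (subst (suc r ≤_) k⊔r≡r r<k⊔r))

module _ {m} (D : Digraph (suc m)) (v : Fin (suc m))
         (preserves : ∀ x y → dist (D ─ v) x y ≡ dist D (punchIn v x) (punchIn v y)) where

  private
    ι : Fin m → Fin (suc m)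
    ι = punchIn v

  DistLe-─⇒ : ∀ {x y k} → DistLe (D ─ v) x y k → DistLe D (ι x) (ι y) k
  DistLe-─⇒ (d , eq , d≤k) = d , trans (sym (preserves _ _)) eq , d≤k

  DistLe⇒─ : ∀ {x y k} → DistLe D (ι x) (ι y) k → DistLe (D ─ v) x y k
  DistLe⇒─ (d , eq , d≤k) = d , trans (preserves _ _) eq , d≤k

  OutradiusIs-─ : ∀ r → OutradiusIs D r → ∃[ x ] EccLe D (ι x) r →
                  (∀ x → (∃[ y ] ¬ DistLe D (ι x) (ι y) (r ∸ 1)) ⊎ DistLe D (ι x) v (r ∸ 1)) →
                  OutradiusIs (D ─ v) r
  OutradiusIs-─ r (_ , ecc≥r) (c , ecc-c) far-or-near =
    (c , λ y → DistLe⇒─ (ecc-c (ι y))) , ecc′≥r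
    where
    ecc′≥r : ∀ x k → EccLe (D ─ v) x k → r ≤ k
    ecc′≥r x k ecc′ with far-or-near x
    ... | inj₁ (y , far) with r ≤? k
    ...   | yes r≤k = r≤k
    ...   | no r≰k  = ⊥-elim (far (DistLe-weaken (∸-monoˡ-≤ 1 (≰⇒> r≰k))
                                                  (DistLe-─⇒ (ecc′ y))))
    ecc′≥r x k ecc′ | inj₂ near = ≤⊔∸1⇒≤ r k (ecc≥r (ι x) (k ⊔ (r ∸ 1)) ecc)
      where
      ecc : EccLe D (ι x) (k ⊔ (r ∸ 1))
      ecc z with z ≟ v
      ... | yes refl = DistLe-weaken (m≤n⊔m k (r ∸ 1)) near
      ... | no z≢v with punchIn-onto z≢v
      ...   | y , refl = DistLe-weaken (m≤m⊔n k (r ∸ 1)) (DistLe-─⇒ (ecc′ y))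

2*nC2≡n*[n∸1] : ∀ n → 2 * (n C 2) ≡ n * (n ∸ 1)
2*nC2≡n*[n∸1] zero          = refl
2*nC2≡n*[n∸1] (suc zero)    = refl
2*nC2≡n*[n∸1] (suc (suc n)) = begin
  2 * (suc (suc n) C 2)        ≡⟨ cong (2 *_) (nCk+nC[k+1]≡[n+1]C[k+1] (suc n) 1) ⟨
  2 * (suc n C 1 + suc n C 2)  ≡⟨ cong (λ t → 2 * (t + suc n C 2)) (nC1≡n (suc n)) ⟩
  2 * (suc n + suc n C 2)      ≡⟨ *-distribˡ-+ 2 (suc n) _ ⟩
  2 * suc n + 2 * (suc n C 2)  ≡⟨ cong (2 * suc n +_) (2*nC2≡n*[n∸1] (suc n)) ⟩
  2 * suc n + suc n * n        ≡⟨ cong (2 * suc n +_) (*-comm (suc n) n) ⟩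
  2 * suc n + n * suc n        ≡⟨ *-distribʳ-+ (suc n) 2 n ⟨
  (2 + n) * suc n              ∎
  where open ≡-Reasoning

≤c+o+i⇒2≤c : ∀ {n c o i} → 2 + 2 * o ≤ n → 2 + 2 * i ≤ n → n ≤ c + o + i → 2 ≤ c
≤c+o+i⇒2≤c {n} {c} {o} {i} o≤ i≤ n≤ = *-cancelˡ-≤ 2 (+-cancelʳ-≤ (2 * o + 2 * i) 4 (2 * c) (begin
  4 + (2 * o + 2 * i)           ≡⟨ regroup o i ⟩
  (2 + 2 * o) + (2 + 2 * i)     ≤⟨ +-mono-≤ o≤ i≤ ⟩
  n + n                         ≡⟨ double n ⟩
  2 * n                         ≤⟨ *-monoʳ-≤ 2 n≤ ⟩
  2 * (c + o + i)               ≡⟨ distribute c o i ⟩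
  2 * c + (2 * o + 2 * i)       ∎))
  where
  open ≤-Reasoning
  regroup : ∀ o i → 4 + (2 * o + 2 * i) ≡ (2 + 2 * o) + (2 + 2 * i)
  regroup = solve-∀
  double : ∀ n → n + n ≡ 2 * n
  double = solve-∀
  distribute : ∀ c o i → 2 * (c + o + i) ≡ 2 * c + (2 * o + 2 * i)
  distribute = solve-∀

threshold : ℕ → ℕ
threshold a = 2 * (1 + 4 * a + 4 * a * (8 * a * a))

h*n≤n+2M⇒h≤2a : ∀ {n h M a} → h * n ≤ n + 2 * M → M < a * n → h ≤ 2 * a
h*n≤n+2M⇒h≤2a {n} {h} {M} {a} h*n≤ M< = s≤s⁻¹ (*-cancelʳ-< n h (1 + 2 * a) (begin-strict
  h * n              ≤⟨ h*n≤ ⟩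
  n + 2 * M          <⟨ +-monoʳ-< n (*-monoʳ-< 2 M<) ⟩
  n + 2 * (a * n)    ≡⟨ regroup n a ⟩
  (1 + 2 * a) * n    ∎))
  where
  open ≤-Reasoning
  regroup : ∀ n a → n + 2 * (a * n) ≡ (1 + 2 * a) * n
  regroup = solve-∀

c*8aa≤M⇒8ac<n : ∀ {n c M a} → c * (8 * a * a) ≤ M → M < a * n → 8 * a * c < n
c*8aa≤M⇒8ac<n {n} {c} {M} {a} c*8aa≤ M< = *-cancelʳ-< a (8 * a * c) n (begin-strict
  8 * a * c * a      ≡⟨ regroup a c ⟩
  c * (8 * a * a)    ≤⟨ c*8aa≤ ⟩
  M                  <⟨ M< ⟩
  a * n              ≡⟨ *-comm a n ⟩
  n * a              ∎)
  where
  open ≤-Reasoning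
  regroup : ∀ a c → 8 * a * c * a ≡ c * (8 * a * a)
  regroup = solve-∀

-- The left-hand side is ∑[ k < 7 ] Choice.obstructionBound k, unfolded.
budget : ∀ {n a hO hI cO cI} → hO ≤ 2 * a → hI ≤ 2 * a → 8 * a * cI < n → 8 * a * cO < n →
         threshold a ≤ n →
         1 + (hI + (hO + (hO * (8 * a * a) + (hO * cI + (hI * (8 * a * a) + (hI * cO + 0)))))) < n
budget {n} {a} {hO} {hI} {cO} {cI} hO≤ hI≤ cI< cO< n₀≤ = *-cancelˡ-< 4 _ n (begin-strict
  4 * (1 + (hI + (hO + (hO * S + (hO * cI + (hI * S + (hI * cO + 0)))))))
    ≤⟨ *-monoʳ-≤ 4 (+-monoʳ-≤ 1 (+-mono-≤ hI≤ (+-mono-≤ hO≤ (+-mono-≤ (*-monoˡ-≤ S hO≤)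
                    (+-mono-≤ (*-monoˡ-≤ cI hO≤) (+-mono-≤ (*-monoˡ-≤ S hI≤) (+-monoˡ-≤ 0 (*-monoˡ-≤ cO hI≤)))))))) ⟩
  4 * (1 + (2 * a + (2 * a + (2 * a * S + (2 * a * cI + (2 * a * S + (2 * a * cO + 0)))))))
    ≡⟨ regroup a S cI cO ⟩
  2 * (2 * (1 + 4 * a + 4 * a * S)) + 8 * a * cI + 8 * a * cO
    <⟨ +-mono-≤-< (+-mono-≤ (*-monoʳ-≤ 2 n₀≤) (<⇒≤ cI<)) cO< ⟩
  2 * n + n + n
    ≡⟨ 4n n ⟩
  4 * n ∎)
  where
  open ≤-Reasoning
  S = 8 * a * a
  regroup : ∀ a S cI cO → 4 * (1 + (2 * a + (2 * a + (2 * a * S + (2 * a * cI + (2 * a * S + (2 * a * cO + 0)))))))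
                          ≡ 2 * (2 * (1 + 4 * a + 4 * a * S)) + 8 * a * cI + 8 * a * cO
  regroup = solve-∀
  4n : ∀ n → 2 * n + n + n ≡ 4 * n
  4n = solve-∀

-- Missing arcs and the Wiener index

sumMaybe-++ : ∀ xs ys {w} → sumMaybe (xs ++ ys) ≡ just w →
              ∃[ w₁ ] ∃[ w₂ ] (sumMaybe xs ≡ just w₁ × sumMaybe ys ≡ just w₂ × w ≡ w₁ + w₂)
sumMaybe-++ []             ys eq = 0 , _ , refl , eq , refl
sumMaybe-++ (just x ∷ xs)  ys eq with sumMaybe (xs ++ ys) in eq′
sumMaybe-++ (just x ∷ xs)  ys refl | just s with sumMaybe-++ xs ys eq′
... | w₁ , w₂ , eq₁ , eq₂ , refl rewrite eq₁ = x + w₁ , w₂ , refl , eq₂ , sym (+-assoc x w₁ w₂)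

∑≤sumMaybe : ∀ {n} (e : Fin n → Maybe ℕ) (g : Fin n → ℕ) → (∀ i {d} → e i ≡ just d → g i ≤ d) →
             ∀ {w} → sumMaybe (tabulate e) ≡ just w → sum g ≤ w
∑≤sumMaybe {zero}  e g g≤e refl = z≤n
∑≤sumMaybe {suc n} e g g≤e eq with e zero in e₀
... | just d with sumMaybe (tabulate (λ i → e (suc i))) in eq′
∑≤sumMaybe {suc n} e g g≤e refl | just d | just s =
  +-mono-≤ (g≤e zero e₀) (∑≤sumMaybe (e ∘ suc) (g ∘ suc) (g≤e ∘ suc) eq′)

∑≤sumMaybe-concat : ∀ {n} (E : Fin n → List (Maybe ℕ)) (g : Fin n → ℕ) →
                    (∀ i {w} → sumMaybe (E i) ≡ just w → g i ≤ w) →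
                    ∀ {w} → sumMaybe (concat (tabulate E)) ≡ just w → sum g ≤ w
∑≤sumMaybe-concat {zero}  E g g≤E refl = z≤n
∑≤sumMaybe-concat {suc n} E g g≤E eq with sumMaybe-++ (E zero) (concat (tabulate (E ∘ suc))) eq
... | w₁ , w₂ , eq₁ , eq₂ , refl =
  +-mono-≤ (g≤E zero eq₁) (∑≤sumMaybe-concat (E ∘ suc) (g ∘ suc) (g≤E ∘ suc) eq₂)

module Gaps {n} (D : Digraph n) where

  missingArc : Fin n → Fin n → Bool
  missingArc u z = not ⌊ u ≟ z ⌋ ∧ not (arc D u z)

  outGap inGap outdeg indeg : Fin n → ℕ
  outGap u = count (missingArc u)
  inGap  z = count (λ u → missingArc u z)
  outdeg u = count (arc D u)
  indeg  z = count (λ u → arc D u z)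

  middles : Fin n → Fin n → ℕ
  middles p q = count (λ w → arc D p w ∧ arc D w q)

  missing : ℕ
  missing = ∑[ u < n ] outGap u

  ∑inGap≡missing : ∑[ z < n ] inGap z ≡ missing
  ∑inGap≡missing = sym (∑-comm (λ u z → 𝟙 (missingArc u z)))

  missingArc-intro : ∀ {u z} → u ≢ z → ¬ T (arc D u z) → T (missingArc u z)
  missingArc-intro u≢z ¬a = Equivalence.from T-∧ (fromWitnessFalse u≢z , T-not ¬a)

  𝟙-arc+missingArc : ∀ u z → 𝟙 (arc D u z) + 𝟙 (missingArc u z) ≡ 𝟙 (not ⌊ u ≟ z ⌋)
  𝟙-arc+missingArc u z with u ≟ z
  ... | yes refl rewrite loopless D u = refl
  ... | no _ with arc D u z
  ...   | true  = refl
  ...   | false = refl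

  outdeg+outGap : ∀ u → outdeg u + outGap u ≡ n ∸ 1
  outdeg+outGap u = begin
    outdeg u + outGap u
      ≡⟨ ∑-distrib-+ (𝟙 ∘ arc D u) (𝟙 ∘ missingArc u) ⟨
    ∑[ z < n ] (𝟙 (arc D u z) + 𝟙 (missingArc u z))
      ≡⟨ sum-cong-≗ (𝟙-arc+missingArc u) ⟩
    count (λ z → not ⌊ u ≟ z ⌋)
      ≡⟨ count-≢ u ⟩
    n ∸ 1 ∎
    where open ≡-Reasoning

  indeg+inGap : ∀ z → indeg z + inGap z ≡ n ∸ 1
  indeg+inGap z = begin
    indeg z + inGap z
      ≡⟨ ∑-distrib-+ (λ u → 𝟙 (arc D u z)) (λ u → 𝟙 (missingArc u z)) ⟨
    ∑[ u < n ] (𝟙 (arc D u z) + 𝟙 (missingArc u z))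
      ≡⟨ sum-cong-≗ (λ u → 𝟙-arc+missingArc u z) ⟩
    count (λ u → not ⌊ u ≟ z ⌋)
      ≡⟨ sum-cong-≗ (λ u → cong (𝟙 ∘ not) (⌊≟⌋-comm u z)) ⟩
    count (λ u → not ⌊ z ≟ u ⌋)
      ≡⟨ count-≢ z ⟩
    n ∸ 1 ∎
    where open ≡-Reasoning

  n≤middles+gaps : ∀ {p q} → p ≢ q → ¬ T (arc D p q) → n ≤ middles p q + outGap p + inGap q
  n≤middles+gaps {p} {q} p≢q ¬pq = begin
    n
      ≡⟨ ∑1≡n n ⟨
    ∑[ w < n ] 1
      ≤⟨ ∑-mono-≤ (𝟙-covers ∘ covered) ⟩
    ∑[ w < n ] (𝟙 (arc D p w ∧ arc D w q) + 𝟙 (missingArc p w) + 𝟙 (missingArc w q))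
      ≡⟨ ∑-distrib-+ (λ w → 𝟙 (arc D p w ∧ arc D w q) + 𝟙 (missingArc p w)) (λ w → 𝟙 (missingArc w q)) ⟩
    ∑[ w < n ] (𝟙 (arc D p w ∧ arc D w q) + 𝟙 (missingArc p w)) + inGap q
      ≡⟨ cong (_+ inGap q) (∑-distrib-+ (λ w → 𝟙 (arc D p w ∧ arc D w q)) (𝟙 ∘ missingArc p)) ⟩
    middles p q + outGap p + inGap q ∎
    where
    open ≤-Reasoning
    covered : ∀ w → T (arc D p w ∧ arc D w q) ⊎ T (missingArc p w) ⊎ T (missingArc w q)
    covered w with w ≟ p | q ≟ w
    ... | yes refl | _        = inj₂ (inj₂ (missingArc-intro p≢q ¬pq))
    ... | no _     | yes refl = inj₂ (inj₁ (missingArc-intro p≢q ¬pq))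
    ... | no w≢p   | no q≢w with T? (arc D p w) | T? (arc D w q)
    ...   | yes pw | yes wq = inj₁ (Equivalence.from T-∧ (pw , wq))
    ...   | yes _  | no ¬wq = inj₂ (inj₂ (missingArc-intro (q≢w ∘ sym) ¬wq))
    ...   | no ¬pw | _      = inj₂ (inj₁ (missingArc-intro (w≢p ∘ sym) ¬pw))

  lowerDist : Fin n → Fin n → ℕ
  lowerDist u z = 𝟙 (not ⌊ u ≟ z ⌋) + 𝟙 (missingArc u z)

  lowerDist≤dist : ∀ u z {d} → dist D u z ≡ just d → lowerDist u z ≤ d
  lowerDist≤dist u z {d} eq with u ≟ z
  ... | yes refl = z≤n
  ... | no u≢z = bound d (reached (least-sound (λ k → reach D k u z) n eq))
    where
    bound : ∀ d → Reach D d u z → 1 + 𝟙 (not (arc D u z)) ≤ d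
    bound zero          r = ⊥-elim (u≢z (reach-zero D r))
    bound (suc zero)    r with arc D u z | reach-arc D u≢z r
    ... | true | _ = ≤-refl
    bound (suc (suc d)) r = s≤s (≤-trans (𝟙≤1 _) (s≤s z≤n))

  W-≥ : ∀ {w} → W D ≡ just w → n * (n ∸ 1) + missing ≤ w
  W-≥ {w} W≡w = begin
    n * (n ∸ 1) + missing                                                   ≡⟨ lower≡ ⟨
    ∑[ u < n ] ∑[ z < n ] lowerDist u z                                     ≤⟨ ∑≤sumMaybe-concat _ _ row≤ tabulated ⟩
    w                                                                       ∎
    where
    open ≤-Reasoning
    row≤ : ∀ u {w} → sumMaybe (tabulate (dist D u)) ≡ just w → ∑[ z < n ] lowerDist u z ≤ w
    row≤ u = ∑≤sumMaybe (dist D u) (lowerDist u) (lowerDist≤dist u)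
    tabulated : sumMaybe (concat (tabulate (λ u → tabulate (dist D u)))) ≡ just w
    tabulated = trans (cong (sumMaybe ∘ concat)
                        (sym (trans (map-tabulate (λ u → u) (λ u → map (dist D u) (allFin n)))
                                    (tabulate-cong (λ u → map-tabulate (λ z → z) (dist D u))))))
                      W≡w
    lower≡ : ∑[ u < n ] ∑[ z < n ] lowerDist u z ≡ n * (n ∸ 1) + missing
    lower≡ = begin-equality
      ∑[ u < n ] ∑[ z < n ] lowerDist u z
        ≡⟨ sum-cong-≗ (λ u → ∑-distrib-+ (𝟙 ∘ not ∘ ⌊_⌋ ∘ (u ≟_)) (𝟙 ∘ missingArc u)) ⟩
      ∑[ u < n ] (count (λ z → not ⌊ u ≟ z ⌋) + outGap u)
        ≡⟨ ∑-distrib-+ (λ u → count (λ z → not ⌊ u ≟ z ⌋)) outGap ⟩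
      ∑[ u < n ] count (λ z → not ⌊ u ≟ z ⌋) + missing
        ≡⟨ cong (_+ missing) (sum-cong-≗ (count-≢ {n})) ⟩
      ∑[ u < n ] (n ∸ 1) + missing
        ≡⟨ cong (_+ missing) (∑-const n (n ∸ 1)) ⟩
      n * (n ∸ 1) + missing ∎

  missing<a*n : ∀ {a} → WLess D (2 * (n C 2) + a * n) → missing < a * n
  missing<a*n {a} (w , W≡w , w<) = +-cancelˡ-< (n * (n ∸ 1)) missing (a * n) (begin-strict
    n * (n ∸ 1) + missing    ≤⟨ W-≥ W≡w ⟩
    w                        <⟨ w< ⟩
    2 * (n C 2) + a * n      ≡⟨ cong (_+ a * n) (2*nC2≡n*[n∸1] n) ⟩
    n * (n ∸ 1) + a * n      ∎)
    where open ≤-Reasoning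

  outdeg≤inGap : ∀ {p q} → n ≤ 1 + outGap p + inGap q → outdeg p ≤ inGap q
  outdeg≤inGap {p} {q} n≤ = +-cancelʳ-≤ (outGap p) (outdeg p) (inGap q) (begin
    outdeg p + outGap p         ≡⟨ outdeg+outGap p ⟩
    n ∸ 1                       ≤⟨ ∸-monoˡ-≤ 1 n≤ ⟩
    outGap p + inGap q          ≡⟨ +-comm (outGap p) (inGap q) ⟩
    inGap q + outGap p          ∎)
    where open ≤-Reasoning

  indeg≤outGap : ∀ {p q} → n ≤ 1 + outGap p + inGap q → indeg q ≤ outGap p
  indeg≤outGap {p} {q} n≤ = +-cancelʳ-≤ (inGap q) (indeg q) (outGap p) (begin
    indeg q + inGap q           ≡⟨ indeg+inGap q ⟩
    n ∸ 1                       ≤⟨ ∸-monoˡ-≤ 1 n≤ ⟩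
    outGap p + inGap q          ∎)
    where open ≤-Reasoning

  n≤1+gaps : ∀ {p q} → p ≢ q → ¬ T (arc D p q) → middles p q ≤ 1 → n ≤ 1 + outGap p + inGap q
  n≤1+gaps p≢q ¬pq one = ≤-trans (n≤middles+gaps p≢q ¬pq) (+-monoˡ-≤ _ (+-monoˡ-≤ _ one))

  2≤middles : ∀ {p q} → p ≢ q → ¬ T (arc D p q) →
              ¬ n ≤ suc (2 * outGap p) → ¬ n ≤ suc (2 * inGap q) → 2 ≤ middles p q
  2≤middles p≢q ¬pq ¬halfOut ¬halfIn = ≤c+o+i⇒2≤c (≰⇒> ¬halfOut) (≰⇒> ¬halfIn) (n≤middles+gaps p≢q ¬pq)

-- Choosing the vertex to delete

module Choice (a : ℕ) {n} (D : Digraph n) (centre : Fin n) (far : Fin n → Fin n) where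

  open Gaps D

  S : ℕ
  S = 8 * a * a

  halfOutGap halfInGap largeOutGap largeInGap lowOutdeg lowIndeg : Fin n → Bool
  halfOutGap  p = ⌊ n ≤? suc (2 * outGap p) ⌋
  halfInGap   q = ⌊ n ≤? suc (2 * inGap q) ⌋
  largeOutGap p = ⌊ S ≤? outGap p ⌋
  largeInGap  q = ⌊ S ≤? inGap q ⌋
  lowOutdeg   p = ⌊ outdeg p <? S ⌋
  lowIndeg    q = ⌊ indeg q <? S ⌋

  onlyMiddle : Fin n → Fin n → Fin n → Bool
  onlyMiddle p v q = ⌊ middles p q ≤? 1 ⌋ ∧ (arc D p v ∧ arc D v q)

  onlyMiddle-intro : ∀ p v q → middles p q ≤ 1 → T (arc D p v) → T (arc D v q) → T (onlyMiddle p v q)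
  onlyMiddle-intro p v q one pv vq =
    T-∧-intro ⌊ middles p q ≤? 1 ⌋ (arc D p v ∧ arc D v q) (fromWitness one) (T-∧-intro (arc D p v) (arc D v q) pv vq)

  obstruction : Fin 7 → Fin n → ℕ
  obstruction 0F v = 𝟙 ⌊ centre ≟ v ⌋
  obstruction 1F v = 𝟙 (halfInGap v)
  obstruction 2F v = ∑[ x < n ] (𝟙 (halfOutGap x) * 𝟙 ⌊ far x ≟ v ⌋)
  obstruction 3F v = ∑[ p < n ] (𝟙 (halfOutGap p) * 𝟙 (lowOutdeg p ∧ arc D p v))
  obstruction 4F v = ∑[ p < n ] (𝟙 (halfOutGap p) * ∑[ q < n ] (𝟙 (largeInGap q) * 𝟙 (onlyMiddle p v q)))
  obstruction 5F v = ∑[ q < n ] (𝟙 (halfInGap q) * 𝟙 (lowIndeg q ∧ arc D v q))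
  obstruction 6F v = ∑[ q < n ] (𝟙 (halfInGap q) * ∑[ p < n ] (𝟙 (largeOutGap p) * 𝟙 (onlyMiddle p v q)))

  record Unobstructed (v : Fin n) : Set where
    field
      centre≢       : centre ≢ v
      ¬halfInGap    : ¬ n ≤ suc (2 * inGap v)
      far≢          : ∀ x → n ≤ suc (2 * outGap x) → far x ≢ v
      ¬lowOutdeg→   : ∀ p → n ≤ suc (2 * outGap p) → outdeg p < S → ¬ T (arc D p v)
      ¬largeInGap→  : ∀ p q → n ≤ suc (2 * outGap p) → S ≤ inGap q → middles p q ≤ 1 →
                      T (arc D p v) → ¬ T (arc D v q)
      ¬lowIndeg←    : ∀ q → n ≤ suc (2 * inGap q) → indeg q < S → ¬ T (arc D v q)
      ¬largeOutGap← : ∀ p q → n ≤ suc (2 * inGap q) → S ≤ outGap p → middles p q ≤ 1 →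
                      T (arc D p v) → ¬ T (arc D v q)

  unobstructed : ∀ {v} → (∀ k → obstruction k v ≡ 0) → Unobstructed v
  unobstructed {v} none = record
    { centre≢       = λ c≡v → 𝟙-zero (none 0F) (fromWitness c≡v)
    ; ¬halfInGap    = λ half → 𝟙-zero (none 1F) (fromWitness half)
    ; far≢          = λ x half fx≡v →
        𝟙-zero (guarded-∑≡0 halfOutGap (λ x → 𝟙 ⌊ far x ≟ v ⌋) (none 2F) x (fromWitness half)) (fromWitness fx≡v)
    ; ¬lowOutdeg→   = λ p half low pv →
        𝟙-zero (guarded-∑≡0 halfOutGap (λ p → 𝟙 (lowOutdeg p ∧ arc D p v)) (none 3F) p (fromWitness half))
               (T-∧-intro (lowOutdeg p) (arc D p v) (fromWitness low) pv)
    ; ¬largeInGap→  = λ p q half large one pv vq →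
        𝟙-zero (guarded-∑≡0 largeInGap (λ q → 𝟙 (onlyMiddle p v q))
                  (guarded-∑≡0 halfOutGap _ (none 4F) p (fromWitness half)) q (fromWitness large))
               (onlyMiddle-intro p v q one pv vq)
    ; ¬lowIndeg←    = λ q half low vq →
        𝟙-zero (guarded-∑≡0 halfInGap (λ q → 𝟙 (lowIndeg q ∧ arc D v q)) (none 5F) q (fromWitness half))
               (T-∧-intro (lowIndeg q) (arc D v q) (fromWitness low) vq)
    ; ¬largeOutGap← = λ p q half large one pv vq →
        𝟙-zero (guarded-∑≡0 largeOutGap (λ p → 𝟙 (onlyMiddle p v q))
                  (guarded-∑≡0 halfInGap _ (none 6F) q (fromWitness half)) p (fromWitness large))
               (onlyMiddle-intro p v q one pv vq)
    }
    where
    𝟙-zero : ∀ {b} → 𝟙 b ≡ 0 → ¬ T b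
    𝟙-zero {true} ()

  count-onlyMiddle≤1 : ∀ p q → count (λ v → onlyMiddle p v q) ≤ 1
  count-onlyMiddle≤1 p q = count-∧≤ ⌊ middles p q ≤? 1 ⌋ (λ v → arc D p v ∧ arc D v q) 1 toWitness

  obstructionBound : Fin 7 → ℕ
  obstructionBound 0F = 1
  obstructionBound 1F = count halfInGap
  obstructionBound 2F = count halfOutGap
  obstructionBound 3F = count halfOutGap * S
  obstructionBound 4F = count halfOutGap * count largeInGap
  obstructionBound 5F = count halfInGap * S
  obstructionBound 6F = count halfInGap * count largeOutGap

  ∑obstruction≤ : ∀ k → ∑[ v < n ] obstruction k v ≤ obstructionBound k
  ∑obstruction≤ 0F = ≤-reflexive (count-≟ centre)
  ∑obstruction≤ 1F = ≤-refl
  ∑obstruction≤ 2F = ∑∑-guarded≤count halfOutGap (λ x v → 𝟙 ⌊ far x ≟ v ⌋) (≤-reflexive ∘ count-≟ ∘ far)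
  ∑obstruction≤ 3F = ∑∑-guarded≤ halfOutGap (λ p v → 𝟙 (lowOutdeg p ∧ arc D p v)) S
                       (λ p → count-∧≤ (lowOutdeg p) (arc D p) S (<⇒≤ ∘ toWitness))
  ∑obstruction≤ 4F = ∑∑-guarded≤ halfOutGap (λ p v → ∑[ q < n ] (𝟙 (largeInGap q) * 𝟙 (onlyMiddle p v q)))
                       (count largeInGap)
                       (λ p → ∑∑-guarded≤count largeInGap (λ q v → 𝟙 (onlyMiddle p v q)) (count-onlyMiddle≤1 p))
  ∑obstruction≤ 5F = ∑∑-guarded≤ halfInGap (λ q v → 𝟙 (lowIndeg q ∧ arc D v q)) S
                       (λ q → count-∧≤ (lowIndeg q) (λ v → arc D v q) S (<⇒≤ ∘ toWitness))
  ∑obstruction≤ 6F = ∑∑-guarded≤ halfInGap (λ q v → ∑[ p < n ] (𝟙 (largeOutGap p) * 𝟙 (onlyMiddle p v q)))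
                       (count largeOutGap)
                       (λ q → ∑∑-guarded≤count largeOutGap (λ p v → 𝟙 (onlyMiddle p v q))
                                                  (λ p → count-onlyMiddle≤1 p q))

  count-halfOutGap : count halfOutGap * n ≤ n + 2 * missing
  count-halfOutGap = ≤-trans (markov n (λ p → suc (2 * outGap p))) (≤-reflexive (∑[1+2*g]≡n+2*∑g outGap))

  count-halfInGap : count halfInGap * n ≤ n + 2 * missing
  count-halfInGap = ≤-trans (markov n (λ q → suc (2 * inGap q)))
                            (≤-reflexive (trans (∑[1+2*g]≡n+2*∑g inGap) (cong (λ m → n + 2 * m) ∑inGap≡missing)))

  count-largeOutGap : count largeOutGap * S ≤ missing
  count-largeOutGap = markov S outGap

  count-largeInGap : count largeInGap * S ≤ missing
  count-largeInGap = ≤-trans (markov S inGap) (≤-reflexive ∑inGap≡missing)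

  unobstructed-exists : threshold a ≤ n → missing < a * n → ∃[ v ] Unobstructed v
  unobstructed-exists n₀≤n missing< =
    let v , none = ∑<n⇒∃≡0 (λ v → ∑[ k < 7 ] obstruction k v) few in
    v , unobstructed (∑≡0⇒≡0 (λ k → obstruction k v) none)
    where
    hO≤ : count halfOutGap ≤ 2 * a
    hO≤ = h*n≤n+2M⇒h≤2a {n} {count halfOutGap} {missing} {a} count-halfOutGap missing<
    hI≤ : count halfInGap ≤ 2 * a
    hI≤ = h*n≤n+2M⇒h≤2a {n} {count halfInGap} {missing} {a} count-halfInGap missing<
    cI< : 8 * a * count largeInGap < n
    cI< = c*8aa≤M⇒8ac<n {n} {count largeInGap} {missing} {a} count-largeInGap missing<
    cO< : 8 * a * count largeOutGap < n
    cO< = c*8aa≤M⇒8ac<n {n} {count largeOutGap} {missing} {a} count-largeOutGap missing<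
    few : ∑[ v < n ] ∑[ k < 7 ] obstruction k v < n
    few = begin-strict
      ∑[ v < n ] ∑[ k < 7 ] obstruction k v   ≡⟨ ∑-comm (λ v k → obstruction k v) ⟩
      ∑[ k < 7 ] ∑[ v < n ] obstruction k v   ≤⟨ ∑-mono-≤ ∑obstruction≤ ⟩
      ∑[ k < 7 ] obstructionBound k           <⟨ budget {n} {a} hO≤ hI≤ cI< cO< n₀≤n ⟩
      n                                       ∎
      where open ≤-Reasoning

  module _ {v} (unobstructed-v : Unobstructed v) where

    open Unobstructed unobstructed-v

    ¬middles≤1 : ∀ {p q} → p ≢ q → T (arc D p v) → T (arc D v q) → ¬ T (arc D p q) → ¬ middles p q ≤ 1
    ¬middles≤1 {p} {q} p≢q pv vq ¬pq one
      with n ≤? suc (2 * outGap p) | n ≤? suc (2 * inGap q) | S ≤? outGap p | S ≤? inGap q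
    ... | yes halfOut | _          | _         | yes large = ¬largeInGap→ p q halfOut large one pv vq
    ... | yes halfOut | _          | _         | no ¬large =
      ¬lowOutdeg→ p halfOut (≤-<-trans (outdeg≤inGap (n≤1+gaps p≢q ¬pq one)) (≰⇒> ¬large)) pv
    ... | no _        | yes halfIn | yes large | _         = ¬largeOutGap← p q halfIn large one pv vq
    ... | no _        | yes halfIn | no ¬large | _         =
      ¬lowIndeg← q halfIn (≤-<-trans (indeg≤outGap (n≤1+gaps p≢q ¬pq one)) (≰⇒> ¬large)) vq
    ... | no ¬halfOut | no ¬halfIn | _         | _         = 1+n≰n (≤-trans (2≤middles p≢q ¬pq ¬halfOut ¬halfIn) one)

    unobstructed⇒bypass : Bypass D v
    unobstructed⇒bypass {p} {q} p≢q pv vq ¬pq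
      with 2≤count⇒∃≢ (λ w → arc D p w ∧ arc D w q) v (≰⇒> (¬middles≤1 p≢q pv vq ¬pq))
    ... | w , w≢v , pwq = w , w≢v , Equivalence.to T-∧ pwq

    reach₂-unobstructed : ∀ {x} → x ≢ v → ¬ n ≤ suc (2 * outGap x) → Reach D 2 x v
    reach₂-unobstructed {x} x≢v ¬halfOut with T? (arc D x v)
    ... | yes xv = reach-suc D (reach-step D (reach-refl D x) xv)
    ... | no ¬xv with count>0⇒∃ (λ w → arc D x w ∧ arc D w v)
                        (≤-trans (s≤s z≤n) (2≤middles x≢v ¬xv ¬halfOut ¬halfInGap))
    ...   | w , xwv = let xw , wv = Equivalence.to T-∧ xwv in reach-step D (reach-step D (reach-refl D x) xw) wv

DistLe? : ∀ {n} (D : Digraph n) u z k → Dec (DistLe D u z k)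
DistLe? D u z k with dist D u z
... | nothing = no λ ()
... | just d  = map′ (λ d≤k → d , refl , d≤k) (λ { (_ , refl , d≤k) → d≤k }) (d ≤? k)

far-vertex : ∀ {n} {D : Digraph n} {r} → 1 ≤ r → OutradiusIs D r → ∀ x → ∃[ y ] ¬ DistLe D x y (r ∸ 1)
far-vertex {n} {D} {suc r} _ (_ , ecc≥r) x = ¬∀⟶∃¬ n _ (λ y → DistLe? D x y r) (1+n≰n ∘ ecc≥r x r)

module _ {m} (D : Digraph (suc m)) (a r : ℕ) (3≤r : 3 ≤ r) (outradius : OutradiusIs D r) where

  open Gaps D

  private
    far : ∀ x → ∃[ y ] ¬ DistLe D x y (r ∸ 1)
    far = far-vertex (≤-trans (s≤s z≤n) 3≤r) outradius

  open Choice a D (proj₁ (proj₁ outradius)) (proj₁ ∘ far)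

  unobstructed⇒deletable : ∀ {v} → Unobstructed v →
                           OutradiusIs (D ─ v) r × (∀ x y → dist (D ─ v) x y ≡ dist D (punchIn v x) (punchIn v y))
  unobstructed⇒deletable {v} unobstructed-v = OutradiusIs-─ D v preserves r outradius centre′ far-or-near , preserves
    where
    open Unobstructed unobstructed-v

    preserves : ∀ x y → dist (D ─ v) x y ≡ dist D (punchIn v x) (punchIn v y)
    preserves = dist-─ D v (unobstructed⇒bypass unobstructed-v)

    centre′ : ∃[ c ] EccLe D (punchIn v c) r
    centre′ = let c , ιc≡centre = punchIn-onto centre≢ in
              c , subst (λ x → EccLe D x r) (sym ιc≡centre) (proj₂ (proj₁ outradius))

    far-or-near : ∀ x → (∃[ y ] ¬ DistLe D (punchIn v x) (punchIn v y) (r ∸ 1)) ⊎ DistLe D (punchIn v x) v (r ∸ 1)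
    far-or-near x = by-cases (suc m ≤? suc (2 * outGap (punchIn v x)))
      where
      by-cases : Dec (suc m ≤ suc (2 * outGap (punchIn v x))) →
                 (∃[ y ] ¬ DistLe D (punchIn v x) (punchIn v y) (r ∸ 1)) ⊎ DistLe D (punchIn v x) v (r ∸ 1)
      by-cases (yes half) = let y , ιy≡far = punchIn-onto (far≢ (punchIn v x) half) in
        inj₁ (y , subst (λ z → ¬ DistLe D (punchIn v x) z (r ∸ 1)) (sym ιy≡far) (proj₂ (far (punchIn v x))))
      by-cases (no ¬half) = inj₂ (DistLe-weaken (∸-monoˡ-≤ 1 3≤r)
        (reach⇒DistLe D 2 (reach₂-unobstructed unobstructed-v (punchInᵢ≢i v x) ¬half)))

  deletable-vertex : threshold a ≤ suc m → missing < a * suc m →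
                     ∃[ v ] (OutradiusIs (D ─ v) r × (∀ x y → dist (D ─ v) x y ≡ dist D (punchIn v x) (punchIn v y)))
  deletable-vertex n₀≤n missing< =
    let v , unobstructed-v = unobstructed-exists n₀≤n missing< in v , unobstructed⇒deletable unobstructed-v

lemma7 : (r a : ℕ) → 3 ≤ r → 1 ≤ a →
         ∃[ n₀ ] ((n : ℕ) → n₀ ≤ n → (D : Digraph n) →
           OutradiusIs D r → WLess D (2 * (n C 2) + a * n) →
           ∃[ v ] (OutradiusIs (D ─ v) r ×
                   ((x y : Fin (pred n)) →
                      dist (D ─ v) x y ≡ dist D (embed v x) (embed v y))))
lemma7 r a 3≤r _ = threshold a , λ where
  zero    _    D ((() , _) , _) _
  (suc m) n₀≤n D outradius wiener → deletable-vertex D a r 3≤r outradius n₀≤n (Gaps.missing<a*n D {a} wiener)
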